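{- Let $n\in\mathbb{N}$, let $A_n$ be the $n\times n$ Redheffer matrix, $B_n=(\sigma_0(\gcd(i,j)))_{i,j=1}^n$, and $v_n\in\mathbb{R}^n$ with $(v_n)_k=\sigma(k)/k$. There is a universal constant $c>0$ such that for all $n$ and all $1\le i\le n$, $$[(A_n^TA_n-B_n)v_n]_i \le \begin{cases} c\left(n+\sum_{j=2}^n \frac{\sigma_0(j)\sigma(j)}{j}\right) & \text{if } i=1,\\ c\,\sigma_0(i) & \text{otherwise.}\end{cases}$$ Moreover, for every $\varepsilon>0$ there exists $C_\varepsilon$ such that for all $n\in\mathbb{N}$, $$\|(A_n^TA_n-B_n)v_n\| \le C_\varepsilon n^{1+\varepsilon}.$$
   Context: The Redheffer matrix $A_n=(A_{ij})_{i,j=1}^n$ has $A_{ij}=1$ if $j=1$ or $i \mid j$, and $A_{ij}=0$ otherwise. $\sigma_0(m)$ is the number of positive divisors of $m$, $\sigma(m)$ the sum of positive divisors of $m$. $\|\cdot\|$ is the Euclidean norm.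
   Formalization: The parameter ε in the norm bound ranges only over the positive rationals. -}

module Defs where

open import Data.Nat as ℕ using (ℕ; zero; suc)
open import Data.Nat.Divisibility using (_∣?_)
open import Data.Nat.GCD using (gcd)
open import Data.Integer using (+_)
open import Data.Rational using (ℚ; _/_; 0ℚ; 1ℚ; _+_; _*_; _-_)
open import Data.List using (List; []; _∷_; filter; length; map)
open import Data.Nat.ListAction using (sum)
open import Relation.Nullary.Decidable using (⌊_⌋)
open import Data.Bool using (if_then_else_; _∨_)

ℕ→ℚ : ℕ → ℚ
ℕ→ℚ n = (+ n) / 1

-- the list [a, a+1, ..., b]  (empty if b < a)
range : ℕ → ℕ → List ℕ
range a b = Data.List.map (ℕ._+ a) (Data.List.upTo (suc b ℕ.∸ a))

Σℚ : ℕ → ℕ → (ℕ → ℚ) → ℚ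
Σℚ a b f = Data.List.foldr (λ k acc → f k + acc) 0ℚ (range a b)

divisors : ℕ → List ℕ
divisors m = filter (λ d → d ∣? m) (range 1 m)

σ₀ : ℕ → ℕ
σ₀ m = length (divisors m)

σ : ℕ → ℕ
σ m = sum (divisors m)

-- Redheffer matrix entry (1-based indices): A_ij = 1 if j = 1 or i ∣ j, else 0
redheffer : ℕ → ℕ → ℚ
redheffer i j = if ⌊ j ℕ.≟ 1 ⌋ ∨ ⌊ i ∣? j ⌋ then 1ℚ else 0ℚ

AᵀA : ℕ → ℕ → ℕ → ℚ
AᵀA n i j = Σℚ 1 n (λ k → redheffer k i * redheffer k j)

Bmat : ℕ → ℕ → ℚ
Bmat i j = ℕ→ℚ (σ₀ (gcd i j))

-- (v_n)_k = σ(k)/k  (only used for k ≥ 1; value at 0 is 0)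
v : ℕ → ℚ
v zero    = 0ℚ
v (suc k) = (+ σ (suc k)) / suc k

w : ℕ → ℕ → ℚ
w n i = Σℚ 1 n (λ j → (AᵀA n i j - Bmat i j) * v j)

normSq : ℕ → ℚ
normSq n = Σℚ 1 n (λ i → w n i * w n i)

_^ℚ_ : ℚ → ℕ → ℚ
x ^ℚ zero  = 1ℚ
x ^ℚ suc k = x * (x ^ℚ k)

module Submission where

-- (AᵀA)_ij counts the k ≤ n with A_ki = A_kj = 1.  For i, j ≥ 2 these are
-- exactly the common divisors of i and j up to n, so (AᵀA − B)_ij ≤ 0, and for
-- i ≤ n at least all divisors of gcd(i, j) are counted, so (AᵀA − B)_ij ≥ 0.  Hence
-- the i-th entry of (AᵀA − B) v is nonnegative and, for i ≥ 2, bounded by its j = 1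
-- term, at most σ₀(i); for i = 1 the j-th term is at most σ₀(j) v_j (and n for j = 1).
--
-- For the norm, σ(j) ≤ Σ_{e ≤ j} ⌊j/e⌋ and Σ_{m ≤ n} σ₀(m) ≤ Σ_{d ≤ n} ⌊n/d⌋ are
-- harmonic sums, at most (1 + L) times their numerator once n ≤ 2^L ≤ 2n.  This gives
-- ‖(AᵀA − B) v‖² ≤ 5 n² (1 + L)⁴, and since (1 + L)^e ≤ K_e 2^L ≤ 2 K_e n, the
-- logarithmic factor is absorbed by any extra power n^(p/q).

open import Algebra.Properties.CommutativeSemigroup using (interchange)
open import Data.Bool using (Bool; true; false; _∧_; _∨_; if_then_else_)
import Data.Bool.Properties as Bool
open import Data.Empty using (⊥-elim)
import Data.Integer as ℤ
import Data.Integer.Properties as ℤ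
open import Data.List as List using ([]; _∷_; [_]; _++_; _∷ʳ_; filter; length; map; applyUpTo; upTo)
import Data.List.Properties as List
open import Data.List.Relation.Unary.All as All using (All; []; _∷_)
open import Data.List.Relation.Unary.All.Properties using (applyUpTo⁺₁)
open import Data.Nat as ℕ using (ℕ; zero; suc; z≤n; s≤s; z<s; NonZero; _≟_; _+_; _*_; _∸_; _^_; _≤_; _≤?_)
import Data.Nat.Properties as ℕ
open import Data.Nat.Coprimality using (1-coprimeTo; sym)
open import Data.Nat.Divisibility using (_∣_; _∣?_; divides; ∣⇒≤; ∣-trans)
open import Data.Nat.DivMod using (_/_; /-monoˡ-≤; /-monoʳ-≤; /-congˡ; n/1≡n; m*n/n≡m; m/n*n≤m; m<n*o⇒m/o<n)
open import Data.Nat.GCD using (gcd; gcd[m,n]∣m; gcd[m,n]∣n; gcd-greatest; gcd[m,n]≢0)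
open import Data.Nat.ListAction using (sum)
open import Data.Nat.ListAction.Properties using (sum-++)
open import Data.Nat.Tactic.RingSolver using (solve-∀)
open import Data.Product using (Σ; _×_; _,_; ∃-syntax)
open import Data.Rational using (ℚ; mkℚ; 0ℚ; 1ℚ; _<_)
import Data.Rational as Q
import Data.Rational.Properties as Q
open import Data.Rational.Unnormalised as ℚᵘ using (mkℚᵘ)
import Data.Rational.Unnormalised.Properties as ℚᵘ
open import Data.Sum using (inj₁; inj₂)
open import Function using (_∘_)
open import Relation.Binary.PropositionalEquality hiding (sym; [_])
import Relation.Binary.PropositionalEquality as ≡
open import Relation.Nullary using (Dec; yes; no; ¬_)
open import Relation.Nullary.Decidable using (⌊_⌋; isYes≗does; dec-true; dec-false)
open import Relation.Unary using (Decidable)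

open import Defs

+-interchange : ∀ a b c d → (a + b) + (c + d) ≡ (a + c) + (b + d)
+-interchange = interchange ℕ.+-commutativeSemigroup

*-interchange : ∀ a b c d → (a * b) * (c * d) ≡ (a * c) * (b * d)
*-interchange = interchange ℕ.*-commutativeSemigroup

-- ℕ→ℚ goes through normalize (a gcd computation) and is stuck on variables; its
-- normal form ι n is not, and the homomorphism laws hold for ι by computation.
ι : ℕ → ℚ
ι n = mkℚ (ℤ.+ n) 0 (sym (1-coprimeTo n))

ℕ→ℚ≡ι : ∀ n → ℕ→ℚ n ≡ ι n
ℕ→ℚ≡ι n = Q.↥p/↧p≡p (ι n)

ℕ→ℚ-+ : ∀ m n → ℕ→ℚ (m + n) ≡ ℕ→ℚ m Q.+ ℕ→ℚ n
ℕ→ℚ-+ m n = begin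
  (ℤ.+ (m + n)) Q./ 1         ≡⟨ cong (Q._/ 1) (ℤ.pos-+ m n) ⟩
  (ℤ.+ m ℤ.+ ℤ.+ n) Q./ 1     ≡⟨ cong (Q._/ 1) (cong₂ ℤ._+_ (ℤ.*-identityʳ (ℤ.+ m)) (ℤ.*-identityʳ (ℤ.+ n))) ⟨
  ι m Q.+ ι n                 ≡⟨ cong₂ Q._+_ (ℕ→ℚ≡ι m) (ℕ→ℚ≡ι n) ⟨
  ℕ→ℚ m Q.+ ℕ→ℚ n             ∎
  where open ≡-Reasoning

ℕ→ℚ-* : ∀ m n → ℕ→ℚ (m * n) ≡ ℕ→ℚ m Q.* ℕ→ℚ n
ℕ→ℚ-* m n = begin
  (ℤ.+ (m * n)) Q./ 1         ≡⟨ cong (Q._/ 1) (ℤ.pos-* m n) ⟩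
  ι m Q.* ι n                 ≡⟨ cong₂ Q._*_ (ℕ→ℚ≡ι m) (ℕ→ℚ≡ι n) ⟨
  ℕ→ℚ m Q.* ℕ→ℚ n             ∎
  where open ≡-Reasoning

ℕ→ℚ-^ : ∀ m k → ℕ→ℚ m ^ℚ k ≡ ℕ→ℚ (m ^ k)
ℕ→ℚ-^ m zero    = refl
ℕ→ℚ-^ m (suc k) = trans (cong (ℕ→ℚ m Q.*_) (ℕ→ℚ-^ m k)) (≡.sym (ℕ→ℚ-* m (m ^ k)))

ℕ→ℚ-mono-≤ : ∀ {m n} → m ≤ n → ℕ→ℚ m Q.≤ ℕ→ℚ n
ℕ→ℚ-mono-≤ {m} {n} m≤n = subst₂ Q._≤_ (≡.sym (ℕ→ℚ≡ι m)) (≡.sym (ℕ→ℚ≡ι n))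
  (Q.*≤* (subst₂ ℤ._≤_ (≡.sym (ℤ.*-identityʳ (ℤ.+ m))) (≡.sym (ℤ.*-identityʳ (ℤ.+ n))) (ℤ.+≤+ m≤n)))

ℕ→ℚ-nonNeg : ∀ n → 0ℚ Q.≤ ℕ→ℚ n
ℕ→ℚ-nonNeg n = ℕ→ℚ-mono-≤ {0} {n} z≤n

p≤q⇒0≤q-p : ∀ {p q} → p Q.≤ q → 0ℚ Q.≤ q Q.- p
p≤q⇒0≤q-p {p} {q} p≤q = subst (Q._≤ q Q.- p) (Q.+-inverseʳ p) (Q.+-monoˡ-≤ (Q.- p) p≤q)

p≤q⇒p-q≤0 : ∀ {p q} → p Q.≤ q → p Q.- q Q.≤ 0ℚ
p≤q⇒p-q≤0 {p} {q} p≤q = subst (p Q.- q Q.≤_) (Q.+-inverseʳ q) (Q.+-monoˡ-≤ (Q.- q) p≤q)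

0≤q⇒p-q≤p : ∀ p {q} → 0ℚ Q.≤ q → p Q.- q Q.≤ p
0≤q⇒p-q≤p p {q} 0≤q = subst (p Q.- q Q.≤_) (Q.+-identityʳ p) (Q.+-monoʳ-≤ p (Q.neg-antimono-≤ 0≤q))

*-nonNeg : ∀ {p q} → 0ℚ Q.≤ p → 0ℚ Q.≤ q → 0ℚ Q.≤ p Q.* q
*-nonNeg {p} {q} 0≤p 0≤q = Q.nonNegative⁻¹ (p Q.* q)
  {{Q.nonNeg*nonNeg⇒nonNeg p {{Q.nonNegative 0≤p}} q {{Q.nonNegative 0≤q}}}}

*-nonPos-nonNeg : ∀ {p q} → p Q.≤ 0ℚ → 0ℚ Q.≤ q → p Q.* q Q.≤ 0ℚ
*-nonPos-nonNeg {p} {q} p≤0 0≤q = Q.nonPositive⁻¹ (p Q.* q)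
  {{Q.nonPos*nonNeg⇒nonPos p {{Q.nonPositive p≤0}} q {{Q.nonNegative 0≤q}}}}

*-monoʳ-≤-nonNeg : ∀ {p q r} → 0ℚ Q.≤ r → p Q.≤ q → p Q.* r Q.≤ q Q.* r
*-monoʳ-≤-nonNeg {r = r} 0≤r = Q.*-monoʳ-≤-nonNeg r {{Q.nonNegative 0≤r}}

*-mono-≤-nonNeg : ∀ {p q r s} → 0ℚ Q.≤ p → 0ℚ Q.≤ r → p Q.≤ q → r Q.≤ s → p Q.* r Q.≤ q Q.* s
*-mono-≤-nonNeg {q = q} 0≤p 0≤r p≤q r≤s = Q.≤-trans (*-monoʳ-≤-nonNeg 0≤r p≤q)
  (Q.*-monoˡ-≤-nonNeg q {{Q.nonNegative (Q.≤-trans 0≤p p≤q)}} r≤s)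

^ℚ-nonNeg : ∀ {p} k → 0ℚ Q.≤ p → 0ℚ Q.≤ p ^ℚ k
^ℚ-nonNeg zero    _   = ℕ→ℚ-nonNeg 1
^ℚ-nonNeg (suc k) 0≤p = *-nonNeg 0≤p (^ℚ-nonNeg k 0≤p)

^ℚ-mono-≤ : ∀ {p q} k → 0ℚ Q.≤ p → p Q.≤ q → p ^ℚ k Q.≤ q ^ℚ k
^ℚ-mono-≤ zero    0≤p p≤q = Q.≤-refl
^ℚ-mono-≤ (suc k) 0≤p p≤q = *-mono-≤-nonNeg 0≤p (^ℚ-nonNeg k 0≤p) p≤q (^ℚ-mono-≤ k 0≤p p≤q)

-- The summand may assume k ≠ 0, so that terms such as x / k need no junk value at 0.
∑ : ℕ → ((k : ℕ) → .{{NonZero k}} → ℕ) → ℕ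
∑ zero    f = 0
∑ (suc n) f = ∑ n f + f (suc n)

syntax ∑ n (λ k → e) = ∑[ k ≤ n ] e

module _ {f g : (k : ℕ) → .{{NonZero k}} → ℕ} where

  ∑-monoʳ-≤ : ∀ n → (∀ k .{{_ : NonZero k}} → k ≤ n → f k ≤ g k) → ∑ n f ≤ ∑ n g
  ∑-monoʳ-≤ zero    f≤g = z≤n
  ∑-monoʳ-≤ (suc n) f≤g = ℕ.+-mono-≤ (∑-monoʳ-≤ n λ k k≤n → f≤g k (ℕ.m≤n⇒m≤1+n k≤n)) (f≤g (suc n) ℕ.≤-refl)

  ∑-cong : ∀ n → (∀ k .{{_ : NonZero k}} → k ≤ n → f k ≡ g k) → ∑ n f ≡ ∑ n g
  ∑-cong zero    f≡g = refl
  ∑-cong (suc n) f≡g = cong₂ _+_ (∑-cong n λ k k≤n → f≡g k (ℕ.m≤n⇒m≤1+n k≤n)) (f≡g (suc n) ℕ.≤-refl)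

  ∑-distrib-+ : ∀ n → ∑[ k ≤ n ] (f k + g k) ≡ ∑ n f + ∑ n g
  ∑-distrib-+ zero    = refl
  ∑-distrib-+ (suc n) = trans (cong (_+ (f (suc n) + g (suc n))) (∑-distrib-+ n))
                              (+-interchange (∑ n f) (∑ n g) (f (suc n)) (g (suc n)))

module _ (f : (k : ℕ) → .{{NonZero k}} → ℕ) where

  ∑-≤-* : ∀ n {c} → (∀ k .{{_ : NonZero k}} → k ≤ n → f k ≤ c) → ∑ n f ≤ n * c
  ∑-≤-* zero    f≤c = z≤n
  ∑-≤-* (suc n) {c} f≤c = subst (∑ (suc n) f ≤_) (ℕ.+-comm (n * c) c)
    (ℕ.+-mono-≤ (∑-≤-* n λ k k≤n → f≤c k (ℕ.m≤n⇒m≤1+n k≤n)) (f≤c (suc n) ℕ.≤-refl))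

  ∑-monoˡ-≤ : ∀ {m n} → m ≤ n → ∑ m f ≤ ∑ n f
  ∑-monoˡ-≤ {n = zero}  z≤n = z≤n
  ∑-monoˡ-≤ {m} {suc n} m≤1+n with ℕ.m≤n⇒m<n∨m≡n m≤1+n
  ... | inj₁ m<1+n = ℕ.≤-trans (∑-monoˡ-≤ (ℕ.≤-pred m<1+n)) (ℕ.m≤m+n (∑ n f) (f (suc n)))
  ... | inj₂ refl  = ℕ.≤-refl

  term-≤-∑ : ∀ {k n} .{{_ : NonZero k}} → k ≤ n → f k ≤ ∑ n f
  term-≤-∑ {suc k} k≤n = ℕ.≤-trans (ℕ.m≤n+m (f (suc k)) (∑ k f)) (∑-monoˡ-≤ k≤n)

  ∑-vanishing : ∀ n → (∀ k .{{_ : NonZero k}} → k ≤ n → f k ≡ 0) → ∑ n f ≡ 0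
  ∑-vanishing zero    f≡0 = refl
  ∑-vanishing (suc n) f≡0 = cong₂ _+_ (∑-vanishing n λ k k≤n → f≡0 k (ℕ.m≤n⇒m≤1+n k≤n)) (f≡0 (suc n) ℕ.≤-refl)

  ∑-≤-∑-support : ∀ {a} n → (∀ k .{{_ : NonZero k}} → a ℕ.< k → f k ≡ 0) → ∑ n f ≤ ∑ a f
  ∑-≤-∑-support {a} zero    _   = z≤n
  ∑-≤-∑-support {a} (suc n) f≡0 with suc n ≤? a
  ... | yes 1+n≤a = ∑-monoˡ-≤ 1+n≤a
  ... | no  1+n≰a = begin
    ∑ n f + f (suc n)   ≡⟨ cong (∑ n f +_) (f≡0 (suc n) (ℕ.≰⇒> 1+n≰a)) ⟩
    ∑ n f + 0           ≡⟨ ℕ.+-identityʳ (∑ n f) ⟩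
    ∑ n f               ≤⟨ ∑-≤-∑-support n f≡0 ⟩
    ∑ a f               ∎
    where open ℕ.≤-Reasoning

  ∑-≤-unique-support : ∀ n {b} → (∀ k l .{{_ : NonZero k}} .{{_ : NonZero l}} → 0 ℕ.< f k → 0 ℕ.< f l → k ≡ l) →
                       (∀ k .{{_ : NonZero k}} → f k ≤ b) → ∑ n f ≤ b
  ∑-≤-unique-support zero    _      _   = z≤n
  ∑-≤-unique-support (suc n) {b} unique f≤b with f (suc n) in eq
  ... | zero  = subst (_≤ b) (≡.sym (ℕ.+-identityʳ (∑ n f))) (∑-≤-unique-support n unique f≤b)
  ... | suc x = subst (_≤ b) (cong (_+ suc x) (≡.sym (∑-vanishing n below))) (subst (_≤ b) eq (f≤b (suc n)))
    where
    below : ∀ k .{{_ : NonZero k}} → k ≤ n → f k ≡ 0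
    below k k≤n with f k in fk
    ... | zero  = refl
    ... | suc _ = ⊥-elim (ℕ.<⇒≢ (s≤s k≤n) (unique k (suc n) (subst (0 ℕ.<_) (≡.sym fk) z<s) (subst (0 ℕ.<_) (≡.sym eq) z<s)))

  ∑-extend-≤ : ∀ a t {c} → (∀ k .{{_ : NonZero k}} → a ℕ.< k → f k ≤ c) → ∑ (a + t) f ≤ ∑ a f + t * c
  ∑-extend-≤ a zero    f≤c = ℕ.≤-reflexive (trans (cong (λ n → ∑ n f) (ℕ.+-identityʳ a)) (≡.sym (ℕ.+-identityʳ (∑ a f))))
  ∑-extend-≤ a (suc t) {c} f≤c = begin
    ∑ (a + suc t) f                 ≡⟨ cong (λ n → ∑ n f) (ℕ.+-suc a t) ⟩
    ∑ (a + t) f + f (suc (a + t))   ≤⟨ ℕ.+-mono-≤ (∑-extend-≤ a t f≤c) (f≤c (suc (a + t)) (s≤s (ℕ.m≤m+n a t))) ⟩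
    ∑ a f + t * c + c               ≡⟨ ℕ.+-assoc (∑ a f) (t * c) c ⟩
    ∑ a f + (t * c + c)             ≡⟨ cong (∑ a f +_) (ℕ.+-comm (t * c) c) ⟩
    ∑ a f + suc t * c               ∎
    where open ℕ.≤-Reasoning

  ∑-distribʳ-* : ∀ c n → ∑[ k ≤ n ] (f k * c) ≡ ∑ n f * c
  ∑-distribʳ-* c zero    = refl
  ∑-distribʳ-* c (suc n) = trans (cong (_+ f (suc n) * c) (∑-distribʳ-* c n))
                                 (≡.sym (ℕ.*-distribʳ-+ c (∑ n f) (f (suc n))))

∑-comm : ∀ (g : (a : ℕ) → .{{NonZero a}} → (b : ℕ) → .{{NonZero b}} → ℕ) m n →
         ∑[ a ≤ m ] ∑[ b ≤ n ] g a b ≡ ∑[ b ≤ n ] ∑[ a ≤ m ] g a b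
∑-comm g zero    n = ≡.sym (∑-vanishing (λ _ → 0) n λ _ _ → refl)
∑-comm g (suc m) n = trans (cong (_+ ∑[ b ≤ n ] g (suc m) b) (∑-comm g m n)) (≡.sym (∑-distrib-+ n))

𝟙 : Bool → ℕ
𝟙 true  = 1
𝟙 false = 0

𝟙≤1 : ∀ b → 𝟙 b ≤ 1
𝟙≤1 true  = ℕ.≤-refl
𝟙≤1 false = z≤n

module _ {P : Set} where

  ⌊⌋-true : (p? : Dec P) → P → ⌊ p? ⌋ ≡ true
  ⌊⌋-true p? p = trans (isYes≗does p?) (dec-true p? p)

  ⌊⌋-false : (p? : Dec P) → ¬ P → ⌊ p? ⌋ ≡ false
  ⌊⌋-false p? ¬p = trans (isYes≗does p?) (dec-false p? ¬p)

  𝟙-pos : (p? : Dec P) → 0 ℕ.< 𝟙 ⌊ p? ⌋ → P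
  𝟙-pos (yes p) _ = p

module _ {P : ℕ → Set} (P? : Decidable P) where

  length-filter : ∀ xs → length (filter P? xs) ≡ sum (map (λ x → 𝟙 ⌊ P? x ⌋) xs)
  length-filter []       = refl
  length-filter (x ∷ xs) with P? x
  ... | yes _ = cong suc (length-filter xs)
  ... | no  _ = length-filter xs

  sum-filter : ∀ xs → sum (filter P? xs) ≡ sum (map (λ x → 𝟙 ⌊ P? x ⌋ * x) xs)
  sum-filter []       = refl
  sum-filter (x ∷ xs) with P? x
  ... | yes _ = cong₂ _+_ (≡.sym (ℕ.+-identityʳ x)) (sum-filter xs)
  ... | no  _ = sum-filter xs

range-bounds : ∀ a b → All (λ k → a ≤ k × k ≤ b) (range a b)
range-bounds a b = subst (All _) (≡.sym (List.map-upTo (_+ a) (suc b ∸ a)))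
  (applyUpTo⁺₁ (_+ a) (suc b ∸ a) λ {i} i<1+b∸a →
    ℕ.m≤n+m a i , ℕ.≤-pred (subst (suc (i + a) ≤_) (ℕ.m∸n+n≡m (a≤1+b i<1+b∸a)) (ℕ.+-monoˡ-≤ a i<1+b∸a)))
  where
  a≤1+b : ∀ {i} → i ℕ.< suc b ∸ a → a ≤ suc b
  a≤1+b i<1+b∸a = ℕ.<⇒≤ (ℕ.m∸n≢0⇒n<m λ 1+b∸a≡0 → ℕ.<⇒≢ (ℕ.≤-trans (s≤s z≤n) i<1+b∸a) (≡.sym 1+b∸a≡0))

range-unfold : ∀ {a b} → a ≤ b → range a b ≡ a ∷ range (suc a) b
range-unfold {a} {b} a≤b = begin
  map (_+ a) (upTo (suc b ∸ a))              ≡⟨ cong (map (_+ a) ∘ upTo) (ℕ.+-∸-assoc 1 a≤b) ⟩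
  a ∷ map (_+ a) (applyUpTo suc (b ∸ a))     ≡⟨ cong (λ xs → a ∷ map (_+ a) xs) (List.map-upTo suc (b ∸ a)) ⟨
  a ∷ map (_+ a) (map suc (upTo (b ∸ a)))    ≡⟨ cong (a ∷_) (List.map-∘ (upTo (b ∸ a))) ⟨
  a ∷ map (λ i → suc i + a) (upTo (b ∸ a))   ≡⟨ cong (a ∷_) (List.map-cong (λ i → ≡.sym (ℕ.+-suc i a)) (upTo (b ∸ a))) ⟩
  a ∷ range (suc a) b                        ∎
  where open ≡-Reasoning

range-1-suc : ∀ n → range 1 (suc n) ≡ range 1 n ++ [ suc n ]
range-1-suc n = begin
  range 1 (suc n)                 ≡⟨ List.map-upTo (_+ 1) (suc n) ⟩
  applyUpTo (_+ 1) (suc n)        ≡⟨ List.applyUpTo-∷ʳ (_+ 1) n ⟨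
  applyUpTo (_+ 1) n ∷ʳ (n + 1)   ≡⟨ cong₂ _∷ʳ_ (List.map-upTo (_+ 1) n) (ℕ.+-comm 1 n) ⟨
  range 1 n ++ [ suc n ]          ∎
  where open ≡-Reasoning

sum-map-range : ∀ (g : ℕ → ℕ) n → sum (map g (range 1 n)) ≡ ∑[ k ≤ n ] g k
sum-map-range g zero    = refl
sum-map-range g (suc n) = begin
  sum (map g (range 1 (suc n)))               ≡⟨ cong (sum ∘ map g) (range-1-suc n) ⟩
  sum (map g (range 1 n ++ [ suc n ]))        ≡⟨ cong sum (List.map-++ g (range 1 n) [ suc n ]) ⟩
  sum (map g (range 1 n) ++ [ g (suc n) ])    ≡⟨ sum-++ (map g (range 1 n)) [ g (suc n) ] ⟩
  sum (map g (range 1 n)) + (g (suc n) + 0)   ≡⟨ cong₂ _+_ (sum-map-range g n) (ℕ.+-identityʳ (g (suc n))) ⟩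
  ∑[ k ≤ suc n ] g k                          ∎
  where open ≡-Reasoning

Σℚ-unfold : ∀ {a b} f → a ≤ b → Σℚ a b f ≡ f a Q.+ Σℚ (suc a) b f
Σℚ-unfold f a≤b = cong (List.foldr (λ k acc → f k Q.+ acc) 0ℚ) (range-unfold a≤b)

Σℚ-mono-≤ : ∀ {f g} a b → (∀ k → a ≤ k → k ≤ b → f k Q.≤ g k) → Σℚ a b f Q.≤ Σℚ a b g
Σℚ-mono-≤ {f} {g} a b f≤g = go (range a b) (All.map (λ (a≤k , k≤b) → f≤g _ a≤k k≤b) (range-bounds a b))
  where
  go : ∀ ks → All (λ k → f k Q.≤ g k) ks →
       List.foldr (λ k acc → f k Q.+ acc) 0ℚ ks Q.≤ List.foldr (λ k acc → g k Q.+ acc) 0ℚ ks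
  go []       []             = Q.≤-refl
  go (k ∷ ks) (fk≤gk ∷ f≤g) = Q.+-mono-≤ fk≤gk (go ks f≤g)

Σℚ-zero : ∀ a b → Σℚ a b (λ _ → 0ℚ) ≡ 0ℚ
Σℚ-zero a b = go (range a b)
  where
  go : ∀ ks → List.foldr (λ _ acc → 0ℚ Q.+ acc) 0ℚ ks ≡ 0ℚ
  go []       = refl
  go (_ ∷ ks) = trans (Q.+-identityˡ _) (go ks)

Σℚ-nonNeg : ∀ {f} a b → (∀ k → a ≤ k → k ≤ b → 0ℚ Q.≤ f k) → 0ℚ Q.≤ Σℚ a b f
Σℚ-nonNeg {f} a b 0≤f = subst (Q._≤ Σℚ a b f) (Σℚ-zero a b) (Σℚ-mono-≤ a b 0≤f)

Σℚ-nonPos : ∀ {f} a b → (∀ k → a ≤ k → k ≤ b → f k Q.≤ 0ℚ) → Σℚ a b f Q.≤ 0ℚ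
Σℚ-nonPos {f} a b f≤0 = subst (Σℚ a b f Q.≤_) (Σℚ-zero a b) (Σℚ-mono-≤ a b f≤0)

Σℚ-suc-≤ : ∀ {a b} f → a ≤ b → 0ℚ Q.≤ f a → Σℚ (suc a) b f Q.≤ Σℚ a b f
Σℚ-suc-≤ {a} {b} f a≤b 0≤fa = begin
  Σℚ (suc a) b f           ≡⟨ Q.+-identityˡ (Σℚ (suc a) b f) ⟨
  0ℚ Q.+ Σℚ (suc a) b f    ≤⟨ Q.+-monoˡ-≤ (Σℚ (suc a) b f) 0≤fa ⟩
  f a Q.+ Σℚ (suc a) b f   ≡⟨ Σℚ-unfold f a≤b ⟨
  Σℚ a b f                 ∎
  where open Q.≤-Reasoning

Σℚ-ℕ→ℚ : ∀ (g : ℕ → ℕ) n → Σℚ 1 n (λ k → ℕ→ℚ (g k)) ≡ ℕ→ℚ (∑[ k ≤ n ] g k)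
Σℚ-ℕ→ℚ g n = trans (go (range 1 n)) (cong ℕ→ℚ (sum-map-range g n))
  where
  go : ∀ ks → List.foldr (λ k acc → ℕ→ℚ (g k) Q.+ acc) 0ℚ ks ≡ ℕ→ℚ (sum (map g ks))
  go []       = refl
  go (k ∷ ks) = trans (cong (Q._+_ (ℕ→ℚ (g k))) (go ks)) (≡.sym (ℕ→ℚ-+ (g k) (sum (map g ks))))

Σℚ₂-≤-∑ : ∀ {f} n (g : ℕ → ℕ) → 1 ≤ n → (∀ k → 2 ≤ k → k ≤ n → f k Q.≤ ℕ→ℚ (g k)) →
          Σℚ 2 n f Q.≤ ℕ→ℚ (∑[ k ≤ n ] g k)
Σℚ₂-≤-∑ {f} n g 1≤n f≤g = begin
  Σℚ 2 n f                   ≤⟨ Σℚ-mono-≤ 2 n f≤g ⟩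
  Σℚ 2 n (λ k → ℕ→ℚ (g k))   ≤⟨ Σℚ-suc-≤ (λ k → ℕ→ℚ (g k)) 1≤n (ℕ→ℚ-nonNeg (g 1)) ⟩
  Σℚ 1 n (λ k → ℕ→ℚ (g k))   ≡⟨ Σℚ-ℕ→ℚ g n ⟩
  ℕ→ℚ (∑[ k ≤ n ] g k)       ∎
  where open Q.≤-Reasoning

-- Divisor sums

σ₀≡∑ : ∀ m → σ₀ m ≡ ∑[ d ≤ m ] 𝟙 ⌊ d ∣? m ⌋
σ₀≡∑ m = trans (length-filter (_∣? m) (range 1 m)) (sum-map-range _ m)

σ≡∑ : ∀ m → σ m ≡ ∑[ d ≤ m ] (𝟙 ⌊ d ∣? m ⌋ * d)
σ≡∑ m = trans (sum-filter (_∣? m) (range 1 m)) (sum-map-range _ m)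

σ₀[m]≤m : ∀ m → σ₀ m ≤ m
σ₀[m]≤m m = subst₂ _≤_ (≡.sym (σ₀≡∑ m)) (ℕ.*-identityʳ m) (∑-≤-* _ m λ d _ → 𝟙≤1 _)

∑[k∣g]≤σ₀[g] : ∀ n {g} .{{_ : NonZero g}} → ∑[ k ≤ n ] 𝟙 ⌊ k ∣? g ⌋ ≤ σ₀ g
∑[k∣g]≤σ₀[g] n {g} = subst (∑[ k ≤ n ] 𝟙 ⌊ k ∣? g ⌋ ≤_) (≡.sym (σ₀≡∑ g))
  (∑-≤-∑-support _ n λ k g<k → cong 𝟙 (⌊⌋-false (k ∣? g) λ k∣g → ℕ.<⇒≱ g<k (∣⇒≤ k∣g)))

σ₀[g]≤∑[k∣g] : ∀ {g n} → g ≤ n → σ₀ g ≤ ∑[ k ≤ n ] 𝟙 ⌊ k ∣? g ⌋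
σ₀[g]≤∑[k∣g] {g} {n} g≤n = subst (_≤ ∑[ k ≤ n ] 𝟙 ⌊ k ∣? g ⌋) (≡.sym (σ₀≡∑ g)) (∑-monoˡ-≤ _ g≤n)

∑[d∣m]≤n/d : ∀ d .{{_ : NonZero d}} n → ∑[ m ≤ n ] 𝟙 ⌊ d ∣? m ⌋ ≤ n / d
∑[d∣m]≤n/d d zero    = z≤n
∑[d∣m]≤n/d d (suc n) with d ∣? suc n
... | no  _ = subst (_≤ suc n / d) (≡.sym (ℕ.+-identityʳ _))
                (ℕ.≤-trans (∑[d∣m]≤n/d d n) (/-monoˡ-≤ d (ℕ.n≤1+n n)))
... | yes (divides c 1+n≡cd) = begin
  ∑[ m ≤ n ] 𝟙 ⌊ d ∣? m ⌋ + 1   ≤⟨ ℕ.+-monoˡ-≤ 1 (∑[d∣m]≤n/d d n) ⟩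
  n / d + 1                     ≡⟨ ℕ.+-comm (n / d) 1 ⟩
  suc (n / d)                   ≤⟨ m<n*o⇒m/o<n (subst (n ℕ.<_) 1+n≡cd ℕ.≤-refl) ⟩
  c                             ≡⟨ m*n/n≡m c d ⟨
  c * d / d                     ≡⟨ /-congˡ 1+n≡cd ⟨
  suc n / d                     ∎
  where open ℕ.≤-Reasoning

∑σ₀≤∑n/d : ∀ n → ∑[ m ≤ n ] σ₀ m ≤ ∑[ d ≤ n ] (n / d)
∑σ₀≤∑n/d n = begin
  ∑[ m ≤ n ] σ₀ m                      ≤⟨ ∑-monoʳ-≤ n (λ m m≤n → σ₀[g]≤∑[k∣g] m≤n) ⟩
  ∑[ m ≤ n ] ∑[ d ≤ n ] 𝟙 ⌊ d ∣? m ⌋   ≡⟨ ∑-comm (λ m d → 𝟙 ⌊ d ∣? m ⌋) n n ⟩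
  ∑[ d ≤ n ] ∑[ m ≤ n ] 𝟙 ⌊ d ∣? m ⌋   ≤⟨ ∑-monoʳ-≤ n (λ d _ → ∑[d∣m]≤n/d d n) ⟩
  ∑[ d ≤ n ] (n / d)                   ∎
  where open ℕ.≤-Reasoning

-- Each divisor d of j is traded for the term j / e of its cofactor e, and a cofactor
-- determines its divisor.
σ[j]≤∑j/e : ∀ j → σ j ≤ ∑[ e ≤ j ] (j / e)
σ[j]≤∑j/e j = begin
  σ j                                                ≡⟨ σ≡∑ j ⟩
  ∑[ d ≤ j ] (𝟙 ⌊ d ∣? j ⌋ * d)                      ≤⟨ ∑-monoʳ-≤ j divisor-≤ ⟩
  ∑[ d ≤ j ] ∑[ e ≤ j ] (𝟙 ⌊ d * e ≟ j ⌋ * (j / e))   ≡⟨ ∑-comm (λ d e → 𝟙 ⌊ d * e ≟ j ⌋ * (j / e)) j j ⟩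
  ∑[ e ≤ j ] ∑[ d ≤ j ] (𝟙 ⌊ d * e ≟ j ⌋ * (j / e))   ≡⟨ ∑-cong j (λ e _ → ∑-distribʳ-* (λ d → 𝟙 ⌊ d * e ≟ j ⌋) (j / e) j) ⟩
  ∑[ e ≤ j ] (∑[ d ≤ j ] 𝟙 ⌊ d * e ≟ j ⌋ * (j / e))   ≤⟨ ∑-monoʳ-≤ j (λ e _ → ℕ.*-monoˡ-≤ (j / e) (cofactor-unique e)) ⟩
  ∑[ e ≤ j ] (1 * (j / e))                           ≡⟨ ∑-cong j (λ e _ → ℕ.*-identityˡ (j / e)) ⟩
  ∑[ e ≤ j ] (j / e)                                 ∎
  where
  open ℕ.≤-Reasoning
  divisor-≤ : ∀ d .{{_ : NonZero d}} → d ≤ j → 𝟙 ⌊ d ∣? j ⌋ * d ≤ ∑[ e ≤ j ] (𝟙 ⌊ d * e ≟ j ⌋ * (j / e))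
  divisor-≤ d d≤j with d ∣? j
  ... | no  _ = z≤n
  ... | yes (divides zero j≡0) = ⊥-elim (ℕ.<⇒≱ (ℕ.>-nonZero⁻¹ d) (subst (d ≤_) j≡0 d≤j))
  ... | yes (divides q@(suc _) j≡qd) =
    subst (_≤ ∑[ e ≤ j ] (𝟙 ⌊ d * e ≟ j ⌋ * (j / e))) qth-term (term-≤-∑ (λ e → 𝟙 ⌊ d * e ≟ j ⌋ * (j / e)) q≤j)
    where
    dq≡j : d * q ≡ j
    dq≡j = trans (ℕ.*-comm d q) (≡.sym j≡qd)
    q≤j : q ≤ j
    q≤j = subst (q ≤_) (≡.sym j≡qd) (ℕ.m≤m*n q d)
    qth-term : 𝟙 ⌊ d * q ≟ j ⌋ * (j / q) ≡ 1 * d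
    qth-term = cong₂ _*_ (cong 𝟙 (⌊⌋-true (d * q ≟ j) dq≡j)) (trans (/-congˡ (≡.sym dq≡j)) (m*n/n≡m d q))
  cofactor-unique : ∀ e .{{_ : NonZero e}} → ∑[ d ≤ j ] 𝟙 ⌊ d * e ≟ j ⌋ ≤ 1
  cofactor-unique e = ∑-≤-unique-support _ j
    (λ d d′ p p′ → ℕ.*-cancelʳ-≡ d d′ e (trans (𝟙-pos (d * e ≟ j) p) (≡.sym (𝟙-pos (d′ * e ≟ j) p′))))
    (λ d → 𝟙≤1 _)

-- Harmonic sums and logarithmic growth

-- The block 2ᴸ < d ≤ 2ᴸ⁺¹ has 2ᴸ terms, each at most x / (2ᴸ + 1).
∑[d≤2ᴸ]x/d≤x*[1+L] : ∀ x L → ∑[ d ≤ 2 ^ L ] (x / d) ≤ x * suc L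
∑[d≤2ᴸ]x/d≤x*[1+L] x zero    = ℕ.≤-reflexive (trans (n/1≡n x) (≡.sym (ℕ.*-identityʳ x)))
∑[d≤2ᴸ]x/d≤x*[1+L] x (suc L) = begin
  ∑[ d ≤ 2 ^ suc L ] (x / d)                            ≡⟨ cong (λ n → ∑[ d ≤ 2 ^ L + n ] (x / d)) (ℕ.+-identityʳ (2 ^ L)) ⟩
  ∑[ d ≤ 2 ^ L + 2 ^ L ] (x / d)                        ≤⟨ ∑-extend-≤ (x /_) (2 ^ L) (2 ^ L) (λ d 2ᴸ<d → /-monoʳ-≤ x 2ᴸ<d) ⟩
  ∑[ d ≤ 2 ^ L ] (x / d) + 2 ^ L * (x / suc (2 ^ L))    ≤⟨ ℕ.+-mono-≤ (∑[d≤2ᴸ]x/d≤x*[1+L] x L) block-≤ ⟩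
  x * suc L + x                                         ≡⟨ ℕ.+-comm (x * suc L) x ⟩
  x + x * suc L                                         ≡⟨ ℕ.*-suc x (suc L) ⟨
  x * suc (suc L)                                       ∎
  where
  open ℕ.≤-Reasoning
  block-≤ : 2 ^ L * (x / suc (2 ^ L)) ≤ x
  block-≤ = ℕ.≤-trans (ℕ.*-monoˡ-≤ (x / suc (2 ^ L)) (ℕ.n≤1+n (2 ^ L)))
              (subst (_≤ x) (ℕ.*-comm (x / suc (2 ^ L)) (suc (2 ^ L))) (m/n*n≤m x (suc (2 ^ L))))

dyadic-bracket : ∀ {n} → 1 ≤ n → ∃[ L ] n ≤ 2 ^ L × 2 ^ L ≤ 2 * n
dyadic-bracket {suc zero}    _ = 0 , ℕ.≤-refl , s≤s z≤n
dyadic-bracket {suc (suc m)} _ with dyadic-bracket {suc m} (s≤s z≤n)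
... | L , 1+m≤2ᴸ , 2ᴸ≤2+2m with suc (suc m) ≤? 2 ^ L
...   | yes 2+m≤2ᴸ = L , 2+m≤2ᴸ , ℕ.≤-trans 2ᴸ≤2+2m (ℕ.*-monoʳ-≤ 2 (ℕ.n≤1+n (suc m)))
...   | no  2+m≰2ᴸ = suc L , ℕ.≤-trans 2+m≤2[1+m] (ℕ.*-monoʳ-≤ 2 1+m≤2ᴸ) , ℕ.*-monoʳ-≤ 2 2ᴸ≤2+m
  where
  2ᴸ≤2+m : 2 ^ L ≤ suc (suc m)
  2ᴸ≤2+m = ℕ.≤-trans (ℕ.≤-pred (ℕ.≰⇒> 2+m≰2ᴸ)) (ℕ.n≤1+n (suc m))
  2+m≤2[1+m] : suc (suc m) ≤ 2 * suc m
  2+m≤2[1+m] = s≤s (subst (suc m ≤_) (≡.sym (ℕ.+-suc m (m + 0))) (s≤s (ℕ.m≤m+n m (m + 0))))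

[1+z]^[1+e]≤z^[1+e]+[1+e]*[1+z]^e : ∀ z e → suc z ^ suc e ≤ z ^ suc e + suc e * suc z ^ e
[1+z]^[1+e]≤z^[1+e]+[1+e]*[1+z]^e z zero    = ℕ.≤-reflexive (linear z)
  where
  linear : ∀ z → suc z * 1 ≡ z * 1 + 1 * 1
  linear = solve-∀
[1+z]^[1+e]≤z^[1+e]+[1+e]*[1+z]^e z (suc e) = begin
  suc z * suc z ^ suc e                                   ≤⟨ ℕ.*-monoʳ-≤ (suc z) ([1+z]^[1+e]≤z^[1+e]+[1+e]*[1+z]^e z e) ⟩
  suc z * (z ^ suc e + suc e * suc z ^ e)                 ≡⟨ expand z (z ^ suc e) (suc z ^ e) e ⟩
  z * z ^ suc e + z ^ suc e + suc e * (suc z ^ suc e)     ≤⟨ ℕ.+-monoˡ-≤ (suc e * suc z ^ suc e)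
                                                               (ℕ.+-monoʳ-≤ (z * z ^ suc e) (ℕ.^-monoˡ-≤ (suc e) (ℕ.n≤1+n z))) ⟩
  z * z ^ suc e + suc z ^ suc e + suc e * suc z ^ suc e   ≡⟨ collect (z * z ^ suc e) (suc z ^ suc e) e ⟩
  z * z ^ suc e + suc (suc e) * suc z ^ suc e             ∎
  where
  open ℕ.≤-Reasoning
  expand : ∀ z p q e → suc z * (p + suc e * q) ≡ z * p + p + suc e * (suc z * q)
  expand = solve-∀
  collect : ∀ a r e → a + r + suc e * r ≡ a + suc (suc e) * r
  collect = solve-∀

polynomial≤exponential : ∀ e → ∃[ K ] ∀ L → suc L ^ e ≤ K * 2 ^ L
polynomial≤exponential zero    = 1 , λ L → subst (1 ≤_) (≡.sym (ℕ.*-identityˡ (2 ^ L))) (ℕ.m^n>0 2 L)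
polynomial≤exponential (suc e) with polynomial≤exponential e
... | K , [1+L]^e≤K2ᴸ = K′ , bound
  where
  K′ : ℕ
  K′ = suc (2 * (suc e * K))
  bound : ∀ L → suc L ^ suc e ≤ K′ * 2 ^ L
  bound zero    = subst₂ _≤_ (≡.sym (ℕ.^-zeroˡ (suc e))) (≡.sym (ℕ.*-identityʳ K′)) (s≤s z≤n)
  bound (suc L) = begin
    suc (suc L) ^ suc e                        ≤⟨ [1+z]^[1+e]≤z^[1+e]+[1+e]*[1+z]^e (suc L) e ⟩
    suc L ^ suc e + suc e * suc (suc L) ^ e    ≤⟨ ℕ.+-mono-≤ (bound L) (ℕ.*-monoʳ-≤ (suc e) ([1+L]^e≤K2ᴸ (suc L))) ⟩
    K′ * 2 ^ L + suc e * (K * (2 * 2 ^ L))     ≡⟨ cong (K′ * 2 ^ L +_) (regroup e K (2 ^ L)) ⟩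
    K′ * 2 ^ L + 2 * (suc e * K) * 2 ^ L       ≤⟨ ℕ.+-monoʳ-≤ (K′ * 2 ^ L) (ℕ.*-monoˡ-≤ (2 ^ L) (ℕ.n≤1+n (2 * (suc e * K)))) ⟩
    K′ * 2 ^ L + K′ * 2 ^ L                    ≡⟨ double K′ (2 ^ L) ⟩
    K′ * (2 * 2 ^ L)                           ∎
    where
    open ℕ.≤-Reasoning
    regroup : ∀ e K x → suc e * (K * (2 * x)) ≡ 2 * (suc e * K) * x
    regroup = solve-∀
    double : ∀ K x → K * x + K * x ≡ K * (2 * x)
    double = solve-∀

^-distribʳ-* : ∀ x y k → (x * y) ^ k ≡ x ^ k * y ^ k
^-distribʳ-* x y zero    = refl
^-distribʳ-* x y (suc k) = trans (cong (x * y *_) (^-distribʳ-* x y k)) (*-interchange x y (x ^ k) (y ^ k))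

polylog-absorption : ∀ {p} q → 1 ≤ p → ∃[ D ] ∀ n L → 2 ^ L ≤ 2 * n →
                     (5 * n ^ 2 * suc L ^ 4) ^ q ≤ D * n ^ (2 * (q + p))
polylog-absorption {p} q 1≤p with polynomial≤exponential (4 * q)
... | K , [1+L]^4q≤K2ᴸ = 5 ^ q * K * 2 , bound
  where
  bound : ∀ n L → 2 ^ L ≤ 2 * n → (5 * n ^ 2 * suc L ^ 4) ^ q ≤ 5 ^ q * K * 2 * n ^ (2 * (q + p))
  bound n L 2ᴸ≤2n = begin
    (5 * n ^ 2 * suc L ^ 4) ^ q             ≡⟨ ^-distribʳ-* (5 * n ^ 2) (suc L ^ 4) q ⟩
    (5 * n ^ 2) ^ q * (suc L ^ 4) ^ q       ≡⟨ cong₂ _*_ (^-distribʳ-* 5 (n ^ 2) q) (ℕ.^-*-assoc (suc L) 4 q) ⟩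
    5 ^ q * (n ^ 2) ^ q * suc L ^ (4 * q)   ≤⟨ ℕ.*-monoʳ-≤ (5 ^ q * (n ^ 2) ^ q) (ℕ.≤-trans ([1+L]^4q≤K2ᴸ L) (ℕ.*-monoʳ-≤ K 2ᴸ≤2n)) ⟩
    5 ^ q * (n ^ 2) ^ q * (K * (2 * n))     ≡⟨ regroup (5 ^ q) ((n ^ 2) ^ q) K n ⟩
    5 ^ q * K * 2 * ((n ^ 2) ^ q * n)       ≡⟨ cong (5 ^ q * K * 2 *_) (cong₂ _*_ (ℕ.^-*-assoc n 2 q) (≡.sym (ℕ.*-identityʳ n))) ⟩
    5 ^ q * K * 2 * (n ^ (2 * q) * n ^ 1)   ≡⟨ cong (5 ^ q * K * 2 *_) (ℕ.^-distribˡ-+-* n (2 * q) 1) ⟨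
    5 ^ q * K * 2 * n ^ (2 * q + 1)         ≤⟨ ℕ.*-monoʳ-≤ (5 ^ q * K * 2) (ℕ.^-monoʳ-≤ n {{n≢0}} exponent-≤) ⟩
    5 ^ q * K * 2 * n ^ (2 * (q + p))       ∎
    where
    open ℕ.≤-Reasoning
    regroup : ∀ a x K n → a * x * (K * (2 * n)) ≡ a * K * 2 * (x * n)
    regroup = solve-∀
    n≢0 : NonZero n
    n≢0 = ℕ.≢-nonZero λ n≡0 → ℕ.<⇒≱ (ℕ.m^n>0 2 L) (subst (λ m → 2 ^ L ≤ 2 * m) n≡0 2ᴸ≤2n)
    exponent-≤ : 2 * q + 1 ≤ 2 * (q + p)
    exponent-≤ = subst (2 * q + 1 ≤_) (≡.sym (ℕ.*-distribˡ-+ 2 q p)) (ℕ.+-monoʳ-≤ (2 * q) (ℕ.≤-trans 1≤p (ℕ.m≤n*m p 2)))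

-- The Gram matrix of the Redheffer matrix

redhefferᵇ : ℕ → ℕ → Bool
redhefferᵇ k i = ⌊ i ≟ 1 ⌋ ∨ ⌊ k ∣? i ⌋

redhefferᵇ-∣ : ∀ {k i} → k ∣ i → redhefferᵇ k i ≡ true
redhefferᵇ-∣ {k} {i} k∣i = trans (cong (⌊ i ≟ 1 ⌋ ∨_) (⌊⌋-true (k ∣? i) k∣i)) (Bool.∨-zeroʳ _)

redhefferᵇ-≥2 : ∀ k {i} → 2 ≤ i → redhefferᵇ k i ≡ ⌊ k ∣? i ⌋
redhefferᵇ-≥2 k {i} 2≤i with i ≟ 1
... | yes refl = ⊥-elim (ℕ.<-irrefl refl 2≤i)
... | no  _    = refl

gram : ℕ → ℕ → ℕ → ℕ
gram n i j = ∑[ k ≤ n ] 𝟙 (redhefferᵇ k i ∧ redhefferᵇ k j)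

AᵀA≡gram : ∀ n i j → AᵀA n i j ≡ ℕ→ℚ (gram n i j)
AᵀA≡gram n i j = trans
  (List.foldr-cong (λ k acc → cong (Q._+ acc) (entry (redhefferᵇ k i) (redhefferᵇ k j))) refl (range 1 n))
  (Σℚ-ℕ→ℚ (λ k → 𝟙 (redhefferᵇ k i ∧ redhefferᵇ k j)) n)
  where
  entry : ∀ a b → (if a then 1ℚ else 0ℚ) Q.* (if b then 1ℚ else 0ℚ) ≡ ℕ→ℚ (𝟙 (a ∧ b))
  entry true  true  = refl
  entry true  false = refl
  entry false true  = refl
  entry false false = refl

gram-comm : ∀ n i j → gram n i j ≡ gram n j i
gram-comm n i j = ∑-cong n λ k _ → cong 𝟙 (Bool.∧-comm (redhefferᵇ k i) (redhefferᵇ k j))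

gram-≤ : ∀ n i j → gram n i j ≤ n
gram-≤ n i j = subst (gram n i j ≤_) (ℕ.*-identityʳ n) (∑-≤-* _ n λ k _ → 𝟙≤1 _)

gram-≤-σ₀ : ∀ n {i} j → 2 ≤ i → gram n i j ≤ σ₀ i
gram-≤-σ₀ n {i} j 2≤i = ℕ.≤-trans (∑-monoʳ-≤ n λ k _ → ≤-divides k (redhefferᵇ k j))
                                   (∑[k∣g]≤σ₀[g] n {{ℕ.>-nonZero (ℕ.<⇒≤ 2≤i)}})
  where
  ≤-divides : ∀ k b → 𝟙 (redhefferᵇ k i ∧ b) ≤ 𝟙 ⌊ k ∣? i ⌋
  ≤-divides k b rewrite redhefferᵇ-≥2 k 2≤i with ⌊ k ∣? i ⌋
  ... | true  = 𝟙≤1 b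
  ... | false = z≤n

gram-≤-σ₀-gcd : ∀ n {i j} → 2 ≤ i → 2 ≤ j → gram n i j ≤ σ₀ (gcd i j)
gram-≤-σ₀-gcd n {i} {j} 2≤i 2≤j = ℕ.≤-trans (∑-monoʳ-≤ n λ k _ → ≤-divides-gcd k) (∑[k∣g]≤σ₀[g] n {{gcd≢0}})
  where
  gcd≢0 : NonZero (gcd i j)
  gcd≢0 = ℕ.≢-nonZero (gcd[m,n]≢0 i j (inj₁ λ i≡0 → ℕ.<⇒≢ (ℕ.≤-trans (s≤s z≤n) 2≤i) (≡.sym i≡0)))
  ≤-divides-gcd : ∀ k → 𝟙 (redhefferᵇ k i ∧ redhefferᵇ k j) ≤ 𝟙 ⌊ k ∣? gcd i j ⌋
  ≤-divides-gcd k rewrite redhefferᵇ-≥2 k 2≤i | redhefferᵇ-≥2 k 2≤j with k ∣? i | k ∣? j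
  ... | yes k∣i | yes k∣j = ℕ.≤-reflexive (cong 𝟙 (≡.sym (⌊⌋-true (k ∣? gcd i j) (gcd-greatest k∣i k∣j))))
  ... | yes _   | no  _   = z≤n
  ... | no  _   | _       = z≤n

σ₀-gcd-≤-gram : ∀ {n i} j → 1 ≤ i → i ≤ n → σ₀ (gcd i j) ≤ gram n i j
σ₀-gcd-≤-gram {n} {i} j 1≤i i≤n =
  ℕ.≤-trans (σ₀[g]≤∑[k∣g] (ℕ.≤-trans (∣⇒≤ {{ℕ.>-nonZero 1≤i}} (gcd[m,n]∣m i j)) i≤n))
            (∑-monoʳ-≤ n λ k _ → divides-gcd-≤ k)
  where
  divides-gcd-≤ : ∀ k → 𝟙 ⌊ k ∣? gcd i j ⌋ ≤ 𝟙 (redhefferᵇ k i ∧ redhefferᵇ k j)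
  divides-gcd-≤ k with k ∣? gcd i j
  ... | no  _     = z≤n
  ... | yes k∣gcd = ℕ.≤-reflexive (cong 𝟙 (≡.sym (cong₂ _∧_
                      (redhefferᵇ-∣ (∣-trans k∣gcd (gcd[m,n]∣m i j))) (redhefferᵇ-∣ (∣-trans k∣gcd (gcd[m,n]∣n i j))))))

v-nonNeg : ∀ j → 0ℚ Q.≤ v j
v-nonNeg zero    = Q.≤-refl
v-nonNeg (suc k) = Q.nonNegative⁻¹ _ {{Q.normalize-nonNeg (σ (suc k)) (suc k)}}

v-≤ : ∀ j c → σ j ≤ c * j → v j Q.≤ ℕ→ℚ c
v-≤ zero    c _     = ℕ→ℚ-nonNeg c
v-≤ (suc k) c σ≤cj = Q.toℚᵘ-cancel-≤ (ℚᵘ.≤-respˡ-≃ (ℚᵘ.≃-sym (Q.toℚᵘ-fromℚᵘ (mkℚᵘ (ℤ.+ σ (suc k)) k)))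
  (subst (λ x → mkℚᵘ (ℤ.+ σ (suc k)) k ℚᵘ.≤ Q.toℚᵘ x) (≡.sym (ℕ→ℚ≡ι c))
    (ℚᵘ.*≤* (subst₂ ℤ._≤_ (≡.sym (ℤ.*-identityʳ _)) (ℤ.pos-* c (suc k)) (ℤ.+≤+ σ≤cj)))))

AᵀA-B : ℕ → ℕ → ℕ → ℚ
AᵀA-B n i j = AᵀA n i j Q.- Bmat i j

AᵀA-B≡ : ∀ n i j → AᵀA-B n i j ≡ ℕ→ℚ (gram n i j) Q.- ℕ→ℚ (σ₀ (gcd i j))
AᵀA-B≡ n i j = cong (Q._- Bmat i j) (AᵀA≡gram n i j)

AᵀA-B-nonNeg : ∀ {n i} j → 1 ≤ i → i ≤ n → 0ℚ Q.≤ AᵀA-B n i j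
AᵀA-B-nonNeg {n} {i} j 1≤i i≤n =
  subst (0ℚ Q.≤_) (≡.sym (AᵀA-B≡ n i j)) (p≤q⇒0≤q-p (ℕ→ℚ-mono-≤ (σ₀-gcd-≤-gram j 1≤i i≤n)))

AᵀA-B-nonPos : ∀ n {i j} → 2 ≤ i → 2 ≤ j → AᵀA-B n i j Q.≤ 0ℚ
AᵀA-B-nonPos n {i} {j} 2≤i 2≤j =
  subst (Q._≤ 0ℚ) (≡.sym (AᵀA-B≡ n i j)) (p≤q⇒p-q≤0 (ℕ→ℚ-mono-≤ (gram-≤-σ₀-gcd n 2≤i 2≤j)))

AᵀA-B-≤-gram : ∀ n i j → AᵀA-B n i j Q.≤ ℕ→ℚ (gram n i j)
AᵀA-B-≤-gram n i j =
  subst (Q._≤ ℕ→ℚ (gram n i j)) (≡.sym (AᵀA-B≡ n i j)) (0≤q⇒p-q≤p _ (ℕ→ℚ-nonNeg (σ₀ (gcd i j))))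

w-nonNeg : ∀ {n i} → 1 ≤ i → i ≤ n → 0ℚ Q.≤ w n i
w-nonNeg {n} 1≤i i≤n = Σℚ-nonNeg 1 n λ j _ _ → *-nonNeg (AᵀA-B-nonNeg j 1≤i i≤n) (v-nonNeg j)

w-unfold : ∀ {n} i → 1 ≤ n → w n i ≡ AᵀA-B n i 1 Q.+ Σℚ 2 n (λ j → AᵀA-B n i j Q.* v j)
w-unfold {n} i 1≤n = trans (Σℚ-unfold (λ j → AᵀA-B n i j Q.* v j) 1≤n)
                           (cong (Q._+ Σℚ 2 n (λ j → AᵀA-B n i j Q.* v j)) (Q.*-identityʳ (AᵀA-B n i 1)))

w-≤-σ₀ : ∀ n i → 2 ≤ i → i ≤ n → w n i Q.≤ ℕ→ℚ (σ₀ i)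
w-≤-σ₀ n i 2≤i i≤n = begin
  w n i                                                  ≡⟨ w-unfold i (ℕ.≤-trans (ℕ.n≤1+n 1) (ℕ.≤-trans 2≤i i≤n)) ⟩
  AᵀA-B n i 1 Q.+ Σℚ 2 n (λ j → AᵀA-B n i j Q.* v j)     ≤⟨ Q.+-mono-≤ first-≤ (Σℚ-nonPos 2 n rest-≤0) ⟩
  ℕ→ℚ (σ₀ i) Q.+ 0ℚ                                      ≡⟨ Q.+-identityʳ (ℕ→ℚ (σ₀ i)) ⟩
  ℕ→ℚ (σ₀ i)                                             ∎
  where
  open Q.≤-Reasoning
  first-≤ : AᵀA-B n i 1 Q.≤ ℕ→ℚ (σ₀ i)
  first-≤ = Q.≤-trans (AᵀA-B-≤-gram n i 1) (ℕ→ℚ-mono-≤ (gram-≤-σ₀ n 1 2≤i))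
  rest-≤0 : ∀ j → 2 ≤ j → j ≤ n → AᵀA-B n i j Q.* v j Q.≤ 0ℚ
  rest-≤0 j 2≤j _ = *-nonPos-nonNeg (AᵀA-B-nonPos n 2≤i 2≤j) (v-nonNeg j)

w₁-≤ : ∀ n → 1 ≤ n → w n 1 Q.≤ ℕ→ℚ n Q.+ Σℚ 2 n (λ j → ℕ→ℚ (σ₀ j) Q.* v j)
w₁-≤ n 1≤n = begin
  w n 1                                                  ≡⟨ w-unfold 1 1≤n ⟩
  AᵀA-B n 1 1 Q.+ Σℚ 2 n (λ j → AᵀA-B n 1 j Q.* v j)     ≤⟨ Q.+-mono-≤ first-≤ (Σℚ-mono-≤ 2 n rest-≤) ⟩
  ℕ→ℚ n Q.+ Σℚ 2 n (λ j → ℕ→ℚ (σ₀ j) Q.* v j)            ∎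
  where
  open Q.≤-Reasoning
  first-≤ : AᵀA-B n 1 1 Q.≤ ℕ→ℚ n
  first-≤ = Q.≤-trans (AᵀA-B-≤-gram n 1 1) (ℕ→ℚ-mono-≤ (gram-≤ n 1 1))
  rest-≤ : ∀ j → 2 ≤ j → j ≤ n → AᵀA-B n 1 j Q.* v j Q.≤ ℕ→ℚ (σ₀ j) Q.* v j
  rest-≤ j 2≤j _ = *-monoʳ-≤-nonNeg (v-nonNeg j)
    (Q.≤-trans (AᵀA-B-≤-gram n 1 j) (ℕ→ℚ-mono-≤ (subst (_≤ σ₀ j) (gram-comm n j 1) (gram-≤-σ₀ n 1 2≤j))))

v-≤-1+L : ∀ {j} L → j ≤ 2 ^ L → v j Q.≤ ℕ→ℚ (suc L)
v-≤-1+L {j} L j≤2ᴸ = v-≤ j (suc L) (begin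
  σ j                      ≤⟨ σ[j]≤∑j/e j ⟩
  ∑[ e ≤ j ] (j / e)       ≤⟨ ∑-monoˡ-≤ (j /_) j≤2ᴸ ⟩
  ∑[ e ≤ 2 ^ L ] (j / e)   ≤⟨ ∑[d≤2ᴸ]x/d≤x*[1+L] j L ⟩
  j * suc L                ≡⟨ ℕ.*-comm j (suc L) ⟩
  suc L * j                ∎)
  where open ℕ.≤-Reasoning

∑σ₀≤n*[1+L] : ∀ {n} L → n ≤ 2 ^ L → ∑[ m ≤ n ] σ₀ m ≤ n * suc L
∑σ₀≤n*[1+L] {n} L n≤2ᴸ = ℕ.≤-trans (∑σ₀≤∑n/d n) (ℕ.≤-trans (∑-monoˡ-≤ (n /_) n≤2ᴸ) (∑[d≤2ᴸ]x/d≤x*[1+L] n L))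

module _ {n} L (1≤n : 1 ≤ n) (n≤2ᴸ : n ≤ 2 ^ L) where

  w₁-≤-log : w n 1 Q.≤ ℕ→ℚ (n + n * suc L * suc L)
  w₁-≤-log = begin
    w n 1                                         ≤⟨ w₁-≤ n 1≤n ⟩
    ℕ→ℚ n Q.+ Σℚ 2 n (λ j → ℕ→ℚ (σ₀ j) Q.* v j)   ≤⟨ Q.+-monoʳ-≤ (ℕ→ℚ n) (Σℚ₂-≤-∑ n (λ j → σ₀ j * suc L) 1≤n σ₀v≤σ₀[1+L]) ⟩
    ℕ→ℚ n Q.+ ℕ→ℚ (∑[ j ≤ n ] (σ₀ j * suc L))     ≡⟨ cong (Q._+_ (ℕ→ℚ n) ∘ ℕ→ℚ) (∑-distribʳ-* (λ j → σ₀ j) (suc L) n) ⟩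
    ℕ→ℚ n Q.+ ℕ→ℚ (∑[ j ≤ n ] σ₀ j * suc L)       ≤⟨ Q.+-monoʳ-≤ (ℕ→ℚ n) (ℕ→ℚ-mono-≤ (ℕ.*-monoˡ-≤ (suc L) (∑σ₀≤n*[1+L] L n≤2ᴸ))) ⟩
    ℕ→ℚ n Q.+ ℕ→ℚ (n * suc L * suc L)             ≡⟨ ℕ→ℚ-+ n (n * suc L * suc L) ⟨
    ℕ→ℚ (n + n * suc L * suc L)                   ∎
    where
    open Q.≤-Reasoning
    σ₀v≤σ₀[1+L] : ∀ j → 2 ≤ j → j ≤ n → ℕ→ℚ (σ₀ j) Q.* v j Q.≤ ℕ→ℚ (σ₀ j * suc L)
    σ₀v≤σ₀[1+L] j _ j≤n = subst (ℕ→ℚ (σ₀ j) Q.* v j Q.≤_) (≡.sym (ℕ→ℚ-* (σ₀ j) (suc L)))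
      (Q.*-monoˡ-≤-nonNeg (ℕ→ℚ (σ₀ j)) {{Q.nonNegative (ℕ→ℚ-nonNeg (σ₀ j))}} (v-≤-1+L L (ℕ.≤-trans j≤n n≤2ᴸ)))

  normSq-≤-log : normSq n Q.≤ ℕ→ℚ ((n + n * suc L * suc L) * (n + n * suc L * suc L) + n * suc L * n)
  normSq-≤-log = begin
    normSq n                                               ≡⟨ Σℚ-unfold (λ i → w n i Q.* w n i) 1≤n ⟩
    w n 1 Q.* w n 1 Q.+ Σℚ 2 n (λ i → w n i Q.* w n i)     ≤⟨ Q.+-mono-≤ (*-mono-≤-nonNeg w₁-nonNeg w₁-nonNeg w₁-≤-log w₁-≤-log)
                                                                         (Σℚ₂-≤-∑ n (λ i → σ₀ i * n) 1≤n wᵢ²-≤) ⟩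
    ℕ→ℚ T Q.* ℕ→ℚ T Q.+ ℕ→ℚ (∑[ i ≤ n ] (σ₀ i * n))        ≡⟨ cong (Q._+_ (ℕ→ℚ T Q.* ℕ→ℚ T) ∘ ℕ→ℚ) (∑-distribʳ-* (λ i → σ₀ i) n n) ⟩
    ℕ→ℚ T Q.* ℕ→ℚ T Q.+ ℕ→ℚ (∑[ i ≤ n ] σ₀ i * n)          ≤⟨ Q.+-monoʳ-≤ (ℕ→ℚ T Q.* ℕ→ℚ T) (ℕ→ℚ-mono-≤ (ℕ.*-monoˡ-≤ n (∑σ₀≤n*[1+L] L n≤2ᴸ))) ⟩
    ℕ→ℚ T Q.* ℕ→ℚ T Q.+ ℕ→ℚ (n * suc L * n)                ≡⟨ cong (Q._+ ℕ→ℚ (n * suc L * n)) (ℕ→ℚ-* T T) ⟨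
    ℕ→ℚ (T * T) Q.+ ℕ→ℚ (n * suc L * n)                    ≡⟨ ℕ→ℚ-+ (T * T) (n * suc L * n) ⟨
    ℕ→ℚ (T * T + n * suc L * n)                            ∎
    where
    open Q.≤-Reasoning
    T : ℕ
    T = n + n * suc L * suc L
    w₁-nonNeg : 0ℚ Q.≤ w n 1
    w₁-nonNeg = w-nonNeg ℕ.≤-refl 1≤n
    wᵢ²-≤ : ∀ i → 2 ≤ i → i ≤ n → w n i Q.* w n i Q.≤ ℕ→ℚ (σ₀ i * n)
    wᵢ²-≤ i 2≤i i≤n = subst (w n i Q.* w n i Q.≤_) (≡.sym (ℕ→ℚ-* (σ₀ i) n))
      (*-mono-≤-nonNeg wᵢ-nonNeg wᵢ-nonNeg wᵢ≤σ₀ (Q.≤-trans wᵢ≤σ₀ (ℕ→ℚ-mono-≤ (ℕ.≤-trans (σ₀[m]≤m i) i≤n))))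
      where
      wᵢ-nonNeg : 0ℚ Q.≤ w n i
      wᵢ-nonNeg = w-nonNeg (ℕ.<⇒≤ 2≤i) i≤n
      wᵢ≤σ₀ : w n i Q.≤ ℕ→ℚ (σ₀ i)
      wᵢ≤σ₀ = w-≤-σ₀ n i 2≤i i≤n

[n+nb²]²+nbn≤5n²b⁴ : ∀ n L → (n + n * suc L * suc L) * (n + n * suc L * suc L) + n * suc L * n ≤ 5 * n ^ 2 * suc L ^ 4
[n+nb²]²+nbn≤5n²b⁴ n L = ℕ.≤-trans (ℕ.m≤m+n _ _) (ℕ.≤-reflexive (≡.sym (slack n L)))
  where
  slack : ∀ n L → let b = 1 + L in
    5 * (n * (n * 1)) * (b * (b * (b * (b * 1))))
      ≡ (n + n * b * b) * (n + n * b * b) + n * b * n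
        + n * n * (11 * L + 22 * (L * L) + 16 * (L * L * L) + 4 * (L * L * L * L))
  slack = solve-∀

normSq-nonNeg : ∀ n → 0ℚ Q.≤ normSq n
normSq-nonNeg n = Σℚ-nonNeg 1 n λ i 1≤i i≤n → *-nonNeg (w-nonNeg 1≤i i≤n) (w-nonNeg 1≤i i≤n)

-- A `with` on dyadic-bracket would normalise the goal, evaluating the gcd inside ℕ→ℚ
-- on symbolic numbers; the let-pattern avoids that.
normSq-≤-polylog : ∀ {n} → 1 ≤ n → ∃[ L ] 2 ^ L ≤ 2 * n × normSq n Q.≤ ℕ→ℚ (5 * n ^ 2 * suc L ^ 4)
normSq-≤-polylog {n} 1≤n =
  let L , n≤2ᴸ , 2ᴸ≤2n = dyadic-bracket 1≤n in
  L , 2ᴸ≤2n , Q.≤-trans (normSq-≤-log L 1≤n n≤2ᴸ) (ℕ→ℚ-mono-≤ ([n+nb²]²+nbn≤5n²b⁴ n L))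

normSq^q-≤ : ∀ {p q} D → 1 ≤ q → (∀ n L → 2 ^ L ≤ 2 * n → (5 * n ^ 2 * suc L ^ 4) ^ q ≤ D * n ^ (2 * (q + p))) →
             ∀ n → normSq n ^ℚ q Q.≤ ℕ→ℚ D Q.* ℕ→ℚ n ^ℚ (2 * (q + p))
normSq^q-≤ {p} {q} D 1≤q absorb n =
  subst (normSq n ^ℚ q Q.≤_) (trans (ℕ→ℚ-* D _) (cong (ℕ→ℚ D Q.*_) (≡.sym (ℕ→ℚ-^ n (2 * (q + p)))))) (bound n 1≤q)
  where
  bound : ∀ n → 1 ≤ q → normSq n ^ℚ q Q.≤ ℕ→ℚ (D * n ^ (2 * (q + p)))
  bound zero    (s≤s {n = q′} _) = Q.≤-trans (Q.≤-reflexive (Q.*-zeroˡ (0ℚ ^ℚ q′))) (ℕ→ℚ-nonNeg (D * 0 ^ (2 * (q + p))))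
  bound (suc m) _ = let L , 2ᴸ≤2n , normSq≤N = normSq-≤-polylog (s≤s (z≤n {m})) in begin
    normSq (suc m) ^ℚ q                             ≤⟨ ^ℚ-mono-≤ q (normSq-nonNeg (suc m)) normSq≤N ⟩
    ℕ→ℚ (5 * suc m ^ 2 * suc L ^ 4) ^ℚ q            ≡⟨ ℕ→ℚ-^ (5 * suc m ^ 2 * suc L ^ 4) q ⟩
    ℕ→ℚ ((5 * suc m ^ 2 * suc L ^ 4) ^ q)           ≤⟨ ℕ→ℚ-mono-≤ (absorb (suc m) L 2ᴸ≤2n) ⟩
    ℕ→ℚ (D * suc m ^ (2 * (q + p)))                 ∎
    where open Q.≤-Reasoning

lemma3 : Σ ℚ (λ c → (0ℚ < c)
             × ((∀ n → 1 ≤ n →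
                   w n 1 Q.≤ c Q.* (ℕ→ℚ n Q.+ Σℚ 2 n (λ j → ℕ→ℚ (σ₀ j) Q.* v j)))
               × (∀ n i → 2 ≤ i → i ≤ n → w n i Q.≤ c Q.* ℕ→ℚ (σ₀ i))))
         × (∀ (p q : ℕ) → 1 ≤ p → 1 ≤ q →
             Σ ℚ (λ D → ∀ n → normSq n ^ℚ q Q.≤ D Q.* ℕ→ℚ n ^ℚ (2 * (q + p))))
lemma3 = (1ℚ , Q.positive⁻¹ 1ℚ , (λ n 1≤n → ≤-1* (w₁-≤ n 1≤n)) , (λ n i 2≤i i≤n → ≤-1* (w-≤-σ₀ n i 2≤i i≤n)))
       , λ p q 1≤p 1≤q → let D , absorb = polylog-absorption q 1≤p in ℕ→ℚ D , normSq^q-≤ D 1≤q absorb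
  where
  ≤-1* : ∀ {x y} → x Q.≤ y → x Q.≤ 1ℚ Q.* y
  ≤-1* {x} {y} = subst (x Q.≤_) (≡.sym (Q.*-identityˡ y))
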